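{- Let $\Sigma=\{\alpha_1,\alpha_2,\dots\}$ be an infinite countable alphabet, $\upsilon\notin\Sigma$ a variable, $\vec k=(k_n)_{n\in\mathbb N}\subseteq\mathbb N$ an increasing sequence, $\vec w\in L^\infty(\Sigma,\vec k;\upsilon)$, and $\Pi=\{(t,\vec s):t\in L(\Sigma,\vec k;\upsilon),\ \vec s=(s_n)_{n\in\mathbb N}\in L^\infty(\Sigma,\vec k;\upsilon),\ \vec s\prec\vec w,\ t<s_n\ \forall n\in\mathbb N\}$. If $\mathcal R\subseteq\Pi$ satisfies (i) for every $(t,\vec s)\in\Pi$ there exists $(t,\vec s_1)\in\mathcal R$ with $\vec s_1\prec\vec s$, and (ii) for every $(t,\vec s)\in\mathcal R$ and $\vec s_1\prec\vec s$ we have $(t,\vec s_1)\in\mathcal R$, then there exists $\vec u\prec\vec w$ such that $(t,\vec s)\in\mathcal R$ for all $t\in EV(\vec u)$ and all $\vec s\prec\vec u-t$.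
   Context: $\mathbb N=\{1,2,\dots\}$. $L(\Sigma,\vec k;\upsilon)$: functions $w$ from a nonempty finite $\mathrm{dom}(w)\subseteq\mathbb N$ into $\Sigma\cup\{\upsilon\}$ with $w(n)\in\{\upsilon,\alpha_1,\dots,\alpha_{k_n}\}$ and $\upsilon$ attained. $w<u$ iff $\max\mathrm{dom}(w)<\min\mathrm{dom}(u)$; then $w\star u$ is the word on $\mathrm{dom}(w)\cup\mathrm{dom}(u)$ agreeing with $w,u$. $T_0(w)=w$; for $p\in\mathbb N$, $T_p(w)$ replaces each $\upsilon$ at position $n$ by $\alpha_{\min(p,k_n)}$. $L^\infty(\Sigma,\vec k;\upsilon)$: sequences $(w_n)$ with $w_n<w_{n+1}$. $EV(\vec w)$: words $T_{p_1}(w_{n_1})\star\cdots\star T_{p_\lambda}(w_{n_\lambda})$, $n_1<\dots<n_\lambda$, integers $0\le p_i\le k_{n_i}$, some $p_i=0$; $\vec u\prec\vec w$ iff $\vec u\in L^\infty$ with all terms in $EV(\vec w)$. For $\vec u=(u_n)$ and a word $t$, $\vec u-t=(u_n)_{n\ge l}$ where $l=\min\{n:t<u_n\}$. -}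

module Defs where

open import Data.Nat using (ℕ; zero; suc; _<_; _≤_; _⊓_)
open import Data.Product using (_×_; _,_; proj₁; proj₂; ∃)
open import Data.List using (List; map; concatMap)
open import Data.List.Relation.Unary.All using (All)
open import Data.List.Relation.Unary.Any using (Any)
open import Data.List.Relation.Unary.Linked using (Linked)
open import Relation.Binary.PropositionalEquality using (_≡_)

-- Letters: 0 encodes the variable υ, (suc i) encodes α_(suc i) (i.e. α_1, α_2, …).
-- A word is the list of its (position , letter) pairs, listed in increasing
-- order of position (canonical representation of a finite partial map ℕ ⇀ Σ∪{υ}).
Word : Set
Word = List (ℕ × ℕ)

-- Sequences (w_1, w_2, …): the Agda index i stands for the paper's index i+1.
Seq : Set
Seq = ℕ → Word

_<ʷ_ : Word → Word → Set
w <ʷ u = All (λ x → All (λ y → proj₁ x < proj₁ y) u) w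

-- w ∈ L(Σ, k; υ): positions in ℕ = {1,2,…}, strictly increasing (so a function
-- on a finite domain), w(n) ∈ {υ, α_1, …, α_(k n)}, and υ occurs (hence nonempty).
IsWord : (ℕ → ℕ) → Word → Set
IsWord k w =
  Linked (λ x y → proj₁ x < proj₁ y) w
  × All (λ x → 1 ≤ proj₁ x × proj₂ x ≤ k (proj₁ x)) w
  × Any (λ x → proj₂ x ≡ 0) w

-- substitution of υ at position n by α_(min(p, k n)); for p = 0 this gives υ,
-- so T k 0 w = w as in the paper (T_0 = identity).
subst-letter : (ℕ → ℕ) → ℕ → ℕ → ℕ → ℕ
subst-letter k p n zero    = p ⊓ k n
subst-letter k p n (suc a) = suc a

T : (ℕ → ℕ) → ℕ → Word → Word
T k p w = map (λ x → proj₁ x , subst-letter k p (proj₁ x) (proj₂ x)) w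

IsSeq : (ℕ → ℕ) → Seq → Set
IsSeq k s = ∀ n → IsWord k (s n) × (s n <ʷ s (suc n))

-- EV of the tail (s_n)_{n ≥ l+1} (paper indexing), keeping the ORIGINAL indices
-- (so that the bound p_i ≤ k_(n_i) refers to the original index n_i).
-- A choice list ps = [(n_1,p_1), …, (n_λ,p_λ)] (Agda indices) with n_1 < … < n_λ,
-- all n_i ≥ l, 0 ≤ p_i ≤ k_(n_i + 1), some p_i = 0.
EVfrom : (ℕ → ℕ) → ℕ → Seq → Word → Set
EVfrom k l s t = ∃ λ (ps : List (ℕ × ℕ)) →
  Linked (λ x y → proj₁ x < proj₁ y) ps
  × All (λ x → l ≤ proj₁ x × proj₂ x ≤ k (suc (proj₁ x))) ps
  × Any (λ x → proj₂ x ≡ 0) ps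
  × t ≡ concatMap (λ x → T k (proj₂ x) (s (proj₁ x))) ps

EV : (ℕ → ℕ) → Seq → Word → Set
EV k s t = EVfrom k 0 s t

PrecFrom : (ℕ → ℕ) → ℕ → Seq → Seq → Set
PrecFrom k l u s = IsSeq k u × (∀ n → EVfrom k l s (u n))

Prec : (ℕ → ℕ) → Seq → Seq → Set
Prec k u s = PrecFrom k 0 u s

InΠ : (ℕ → ℕ) → Seq → Word → Seq → Set
InΠ k w t s = IsWord k t × IsSeq k s × Prec k s w × (∀ n → t <ʷ s n)

-- Diagonalisation. Stage n has fixed the words u₀ … u_(n-1) and holds a sequence σ ≺ w lying after
-- them; u_n is the n-th term of σ. Only finitely many words t ∈ EV(u₀ … u_n) exist (indices and
-- exponents are bounded), so applying (i) to each of them in turn, along a chain of refinements of the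
-- tail of σ after u_n, gives the next σ with (t, σ) ∈ R for all of them. For m ≥ l every u_m is an EV
-- word of the l-th σ using only its terms of index ≥ m, so each s ≺ u − t refines the l-th σ, where l
-- is past the indices used by t, and (ii) gives (t, s) ∈ R.

module Submission where

open import Defs
open import Data.Nat using (ℕ; zero; suc; _<_; _≤_; _⊓_; z≤n; s≤s; _+_; _<?_; _≤?_; _≟_; _≤′_; ≤′-refl; ≤′-step)
open import Data.Nat.Properties
open import Data.Product using (_×_; _,_; proj₁; proj₂; ∃; Σ; uncurry)
open import Data.List using (List; []; _∷_; _++_; map; concatMap; upTo; filter)
open import Data.List.Properties using (map-id; map-cong; map-concatMap; concatMap-map; concatMap-cong; concatMap-++; ++-identityʳ)
open import Data.List.Relation.Unary.All as All using (All; []; _∷_)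
open import Data.List.Relation.Unary.Any as Any using (Any; here; there)
import Data.List.Relation.Unary.All.Properties as All
import Data.List.Relation.Unary.Any.Properties as Any
open import Data.List.Relation.Unary.Linked as Linked using (Linked; []; [-]; _∷_)
import Data.List.Relation.Unary.Linked.Properties as Linked
open import Data.List.Relation.Unary.AllPairs as AllPairs using (AllPairs; []; _∷_)
open import Data.List.Membership.Propositional using (_∈_)
open import Data.List.Membership.Propositional.Properties using (∈-++⁺ˡ; ∈-++⁺ʳ; ∈-map⁺; ∈-concatMap⁺; ∈-upTo⁺; ∈-filter⁺)
import Data.List.Relation.Unary.AllPairs.Properties as AllPairs
open import Data.Empty using (⊥-elim)
open import Data.Sum using (inj₁; inj₂)
open import Relation.Binary.PropositionalEquality
open import Function using (_∘_)
open import Relation.Nullary using (¬_; Dec; yes; no)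
open import Relation.Nullary.Decidable using (_×-dec_)
open import Relation.Binary using (tri<; tri≈; tri>)

_<₁_ : ℕ × ℕ → ℕ × ℕ → Set
x <₁ y = proj₁ x < proj₁ y

<ʷ-trans : ∀ {w v x : Word} {P : ℕ × ℕ → Set} → Any P v → w <ʷ v → v <ʷ x → w <ʷ x
<ʷ-trans {v = v} {x = x} v≢[] w<v v<x = All.map (λ {e} → through {e}) w<v
  where
  through : ∀ {e} → All (e <₁_) v → All (e <₁_) x
  through e<v = let ((e<f , f<x) , _) = All.lookupAny (All.zip (e<v , v<x)) v≢[] in All.map (<-trans e<f) f<x

<ʷ-irrefl : ∀ {w : Word} {P : ℕ × ℕ → Set} → Any P w → ¬ (w <ʷ w)
<ʷ-irrefl {_ ∷ _} _ ((x<x ∷ _) ∷ _) = <-irrefl refl x<x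

<ʷ-asym : ∀ {w v : Word} {P Q : ℕ × ℕ → Set} → Any P w → Any Q v → w <ʷ v → ¬ (v <ʷ w)
<ʷ-asym w≢[] v≢[] w<v v<w = <ʷ-irrefl w≢[] (<ʷ-trans v≢[] w<v v<w)

T-<ʷ : ∀ {k p q} {x y : Word} → x <ʷ y → T k p x <ʷ T k q y
T-<ʷ x<y = All.map⁺ (All.map All.map⁺ x<y)

compose : ℕ → ℕ → ℕ
compose zero    p = p
compose (suc q) p = suc q

subst-letter-compose : ∀ k p q n c
                     → subst-letter k p n (subst-letter k q n c) ≡ subst-letter k (compose q p) n c
subst-letter-compose k p zero    n zero    = refl
subst-letter-compose k p (suc q) n zero    with k n in kn≡
... | zero  = trans (cong (p ⊓_) kn≡) (⊓-zeroʳ p)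
... | suc _ = refl
subst-letter-compose k p q       n (suc c) = refl

T-compose : ∀ k p q w → T k p (T k q w) ≡ T k (compose q p) w
T-compose k p q []            = refl
T-compose k p q ((n , c) ∷ w) = cong₂ _∷_ (cong (n ,_) (subst-letter-compose k p q n c)) (T-compose k p q w)

T-zero : ∀ k w → T k 0 w ≡ w
T-zero k w = trans (map-cong letter-zero w) (map-id w)
  where
  letter-zero : ∀ (x : ℕ × ℕ) → (proj₁ x , subst-letter k 0 (proj₁ x) (proj₂ x)) ≡ x
  letter-zero (_ , zero)  = refl
  letter-zero (_ , suc _) = refl

assemble : (ℕ → ℕ) → Seq → List (ℕ × ℕ) → Word
assemble k s ps = concatMap (λ x → T k (proj₂ x) (s (proj₁ x))) ps

recompose : ℕ → ℕ × ℕ → ℕ × ℕ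
recompose p x = proj₁ x , compose (proj₂ x) p

T-assemble : ∀ k p s qs → T k p (assemble k s qs) ≡ assemble k s (map (recompose p) qs)
T-assemble k p s qs = begin
  T k p (assemble k s qs)              ≡⟨ map-concatMap _ block qs ⟩
  concatMap (T k p ∘ block) qs         ≡⟨ concatMap-cong (λ x → T-compose k p (proj₂ x) (s (proj₁ x))) qs ⟩
  concatMap (block ∘ recompose p) qs   ≡⟨ concatMap-map block (recompose p) qs ⟨
  assemble k s (map (recompose p) qs)  ∎
  where
  open ≡-Reasoning
  block : ℕ × ℕ → Word
  block x = T k (proj₂ x) (s (proj₁ x))

assemble-cong : ∀ {k s s′} ps → All (λ x → s (proj₁ x) ≡ s′ (proj₁ x)) ps → assemble k s ps ≡ assemble k s′ ps
assemble-cong []             []       = refl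
assemble-cong {k} ((_ , p) ∷ ps) (e ∷ es) = cong₂ _++_ (cong (T k p) e) (assemble-cong ps es)

module _ {k : ℕ → ℕ} {s : Seq} where

  All-assemble⁺ : ∀ {Q : ℕ → Set} {ps} → All (λ x → All (Q ∘ proj₁) (s (proj₁ x))) ps
                → All (Q ∘ proj₁) (assemble k s ps)
  All-assemble⁺ h = All.concat⁺ (All.map⁺ (All.map All.map⁺ h))

  All-assemble⁻ : ∀ {Q : ℕ → Set} ps → All (Q ∘ proj₁) (assemble k s ps)
                → All (λ x → All (Q ∘ proj₁) (s (proj₁ x))) ps
  All-assemble⁻ ps h = All.map All.map⁻ (All.map⁻ (All.concat⁻ h))

  assemble-<ʷ : ∀ {ps} {y : Word} → All (λ x → s (proj₁ x) <ʷ y) ps → assemble k s ps <ʷ y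
  assemble-<ʷ = All-assemble⁺

  assemble-<ʷ⁻ : ∀ ps {y : Word} → assemble k s ps <ʷ y → All (λ x → s (proj₁ x) <ʷ y) ps
  assemble-<ʷ⁻ ps = All-assemble⁻ ps

  <ʷ-assemble : ∀ {ps} {y : Word} → All (λ x → y <ʷ s (proj₁ x)) ps → y <ʷ assemble k s ps
  <ʷ-assemble h = All.tabulate (λ e∈y → All-assemble⁺ (All.map (λ y<sx → All.lookup y<sx e∈y) h))

  <ʷ-assemble⁻ : ∀ ps {y : Word} → y <ʷ assemble k s ps → All (λ x → y <ʷ s (proj₁ x)) ps
  <ʷ-assemble⁻ ps h = All.tabulate (λ x∈ps → All.map (λ e<A → All.lookup (All-assemble⁻ ps e<A) x∈ps) h)

-- The implicit arguments of <-trans cannot be recovered through proj₁, hence the explicit λ.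
Linked⇒AllPairs₁ : ∀ {xs} → Linked _<₁_ xs → AllPairs _<₁_ xs
Linked⇒AllPairs₁ = Linked.Linked⇒AllPairs (λ {x} {y} {z} → <-trans {proj₁ x} {proj₁ y} {proj₁ z})

module _ {k : ℕ → ℕ} where

  IsWord-υ : ∀ {w} → IsWord k w → Any (λ x → proj₂ x ≡ 0) w
  IsWord-υ = proj₂ ∘ proj₂

  IsSeq-<ʷ : ∀ {s} → IsSeq k s → ∀ {i j} → i < j → s i <ʷ s j
  IsSeq-<ʷ ss {i} {suc j} (s≤s i≤j) with m≤n⇒m<n∨m≡n i≤j
  ... | inj₁ i<j  = <ʷ-trans (IsWord-υ (proj₁ (ss j))) (IsSeq-<ʷ ss i<j) (proj₂ (ss j))
  ... | inj₂ refl = proj₂ (ss i)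

  IsSeq-index-< : ∀ {s} → IsSeq k s → ∀ {i j} → s i <ʷ s j → i < j
  IsSeq-index-< {s} ss {i} {j} si<sj with <-cmp i j
  ... | tri< i<j _ _ = i<j
  ... | tri≈ _ refl _ = ⊥-elim (<ʷ-irrefl (IsWord-υ (proj₁ (ss i))) si<sj)
  ... | tri> _ _ j<i =
    ⊥-elim (<ʷ-asym (IsWord-υ (proj₁ (ss i))) (IsWord-υ (proj₁ (ss j))) si<sj (IsSeq-<ʷ ss j<i))

  -- Choice lists are compared index-wise, through the word order on their (index , exponent) pairs.
  assemble-index-< : ∀ {s} → IsSeq k s → ∀ qs qs′ → assemble k s qs <ʷ assemble k s qs′ → qs <ʷ qs′
  assemble-index-< ss qs qs′ h =
    All.map (λ sx<A → All.map (IsSeq-index-< ss) (<ʷ-assemble⁻ qs′ sx<A)) (assemble-<ʷ⁻ qs h)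

  T-letters : ∀ p {w} → All (λ x → 1 ≤ proj₁ x × proj₂ x ≤ k (proj₁ x)) w
            → All (λ x → 1 ≤ proj₁ x × proj₂ x ≤ k (proj₁ x)) (T k p w)
  T-letters p {[]}              []             = []
  T-letters p {(n , zero) ∷ _}  ((1≤n , _) ∷ h) = (1≤n , m⊓n≤n p (k n)) ∷ T-letters p h
  T-letters p {(_ , suc _) ∷ _} (l ∷ h)         = l ∷ T-letters p h

  assemble-υ : ∀ {s ps} → All (λ x → IsWord k (s (proj₁ x))) ps → Any (λ x → proj₂ x ≡ 0) ps
             → Any (λ x → proj₂ x ≡ 0) (assemble k s ps)
  assemble-υ {s} (w ∷ _)  (here refl) = Any.++⁺ˡ (subst (Any _) (sym (T-zero k (s _))) (IsWord-υ w))
  assemble-υ {s} {x ∷ _} (_ ∷ ws) (there υ∈) = Any.++⁺ʳ (T k (proj₂ x) (s (proj₁ x))) (assemble-υ ws υ∈)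

  assemble-IsWord : ∀ {s ps} → All (λ x → IsWord k (s (proj₁ x))) ps
                  → AllPairs (λ x y → s (proj₁ x) <ʷ s (proj₁ y)) ps
                  → Any (λ x → proj₂ x ≡ 0) ps
                  → IsWord k (assemble k s ps)
  assemble-IsWord ws ordered υ∈ =
    Linked.AllPairs⇒Linked (AllPairs.concat⁺
      (All.map⁺ (All.map (λ w → T-increasing (proj₁ w)) ws))
      (AllPairs.map⁺ (AllPairs.map T-<ʷ ordered))) ,
    All.concat⁺ (All.map⁺ (All.map (T-letters _ ∘ proj₁ ∘ proj₂) ws)) ,
    assemble-υ ws υ∈
    where
    T-increasing : ∀ {p w} → Linked _<₁_ w → AllPairs _<₁_ (T k p w)
    T-increasing inc = AllPairs.map⁺ (Linked⇒AllPairs₁ inc)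

EVfrom-mono : ∀ {k a b s t} → a ≤ b → EVfrom k b s t → EVfrom k a s t
EVfrom-mono a≤b (ps , inc , bnd , υ∈ , eq) =
  ps , inc , All.map (λ (b≤i , p≤k) → ≤-trans a≤b b≤i , p≤k) bnd , υ∈ , eq

<ʷ-EVfrom : ∀ {k a τ} {x y : Word} → (∀ j → x <ʷ τ j) → EVfrom k a τ y → x <ʷ y
<ʷ-EVfrom {k} {τ = τ} x<τ (ps , _ , _ , _ , refl) = <ʷ-assemble {k} {τ} {ps} (All.tabulate (λ _ → x<τ _))

Prec-refl : ∀ {k s} → IsSeq k s → Prec k s s
Prec-refl {k} {s} ss = ss , λ j → ((j , 0) ∷ []) , [-] , (z≤n , z≤n) ∷ [] , here refl ,
  sym (trans (++-identityʳ _) (T-zero k (s j)))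

shift : ℕ → Seq → Seq
shift c σ i = σ (c + i)

module _ {k : ℕ → ℕ} where

  IsSeq-shift : ∀ c {σ} → IsSeq k σ → IsSeq k (shift c σ)
  IsSeq-shift c {σ} sσ j =
    proj₁ (sσ (c + j)) , subst (λ i → σ (c + j) <ʷ σ i) (sym (+-suc c j)) (proj₂ (sσ (c + j)))

  Prec-shift : ∀ c {σ w} → Prec k σ w → Prec k (shift c σ) w
  Prec-shift c (sσ , σ∈EV) = IsSeq-shift c sσ , λ j → σ∈EV (c + j)

  -- In a sequence τ' ≺ τ the j-th term only uses terms τ_i with i ≥ j, because the terms
  -- of τ' are increasing and each of them contains a term of τ with exponent 0.
  ≺⇒EVfrom : ∀ {τ τ′} → IsSeq k τ → Prec k τ′ τ → ∀ j → EVfrom k j τ (τ′ j)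
  ≺⇒EVfrom {τ} {τ′} sτ (sτ′ , τ′∈EV) j =
    let (ps , inc , bnd , υ∈ , eq) = τ′∈EV j in ps , inc , All.zip (above j , All.map proj₂ bnd) , υ∈ , eq
    where
    above : ∀ j → All (λ x → j ≤ proj₁ x) (proj₁ (τ′∈EV j))
    above zero    = All.map (λ _ → z≤n) (proj₁ (proj₂ (proj₂ (τ′∈EV zero))))
    above (suc j) =
      let (ps , _ , _ , υ∈ , eq) = τ′∈EV j
          (ps′ , _ , _ , _ , eq′) = τ′∈EV (suc j)
          ps<ps′ = assemble-index-< sτ ps ps′ (subst₂ _<ʷ_ eq eq′ (proj₂ (sτ′ j)))
          ((j≤i , i<ps′) , _) = All.lookupAny (All.zip (above j , ps<ps′)) υ∈
      in All.map (≤-<-trans j≤i) i<ps′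

module _ {k : ℕ → ℕ} (kstep : ∀ n → k (suc n) ≤ k (suc (suc n))) where

  k-mono : ∀ {m n} → m ≤ n → k (suc m) ≤ k (suc n)
  k-mono m≤n = go (≤⇒≤′ m≤n)
    where
    go : ∀ {m n} → m ≤′ n → k (suc m) ≤ k (suc n)
    go ≤′-refl        = ≤-refl
    go (≤′-step m≤′n) = ≤-trans (go m≤′n) (kstep _)

  -- EV of an EV-subsequence: substituting the choice lists of the σ′_m into a choice list over σ′.
  EVfrom-trans : ∀ {σ′ σ a t} → IsSeq k σ′ → IsSeq k σ → (∀ {m} → a ≤ m → EVfrom k m σ (σ′ m))
               → EVfrom k a σ′ t → EVfrom k a σ t
  EVfrom-trans {σ′} {σ} {a} sσ′ sσ σ′∈EV (ps , inc , bnd , υ∈ , refl) =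
    let (qs , inc′ , bnd′ , υ∈′ , eq) = translate ps (Linked⇒AllPairs₁ inc) bnd
    in qs , Linked.AllPairs⇒Linked inc′ , bnd′ , υ∈′ υ∈ , eq
    where
    Bounded : ℕ × ℕ → Set
    Bounded x = a ≤ proj₁ x × proj₂ x ≤ k (suc (proj₁ x))

    recompose-bounded : ∀ {m p} → a ≤ m → p ≤ k (suc m) → ∀ {x} → m ≤ proj₁ x × proj₂ x ≤ k (suc (proj₁ x))
                      → Bounded (recompose p x)
    recompose-bounded a≤m p≤k {_ , zero}  (m≤i , _)   = ≤-trans a≤m m≤i , ≤-trans p≤k (k-mono m≤i)
    recompose-bounded a≤m p≤k {_ , suc _} (m≤i , q≤k) = ≤-trans a≤m m≤i , q≤k

    recompose-υ : ∀ {x} → proj₂ x ≡ 0 → proj₂ (recompose 0 x) ≡ 0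
    recompose-υ {_ , zero} refl = refl

    translate : ∀ ps → AllPairs _<₁_ ps → All Bounded ps
              → ∃ λ qs → AllPairs _<₁_ qs × All Bounded qs
                        × (Any (λ x → proj₂ x ≡ 0) ps → Any (λ x → proj₂ x ≡ 0) qs)
                        × assemble k σ′ ps ≡ assemble k σ qs
    translate [] [] [] = [] , [] , [] , (λ ()) , refl
    translate ((m , p) ∷ ps) (m<ps ∷ inc) ((a≤m , p≤k) ∷ bnd) =
      let (Q , incQ , bndQ , υ∈Q , eqQ) = σ′∈EV a≤m
          (qs , incqs , bndqs , υ∈qs , eqqs) = translate ps inc bnd
          Q<qs = assemble-index-< sσ Q qs (subst₂ _<ʷ_ eqQ eqqs (<ʷ-assemble (All.map (IsSeq-<ʷ sσ′) m<ps)))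
      in map (recompose p) Q ++ qs ,
         AllPairs.++⁺ (AllPairs.map⁺ (Linked⇒AllPairs₁ incQ)) incqs (All.map⁺ Q<qs) ,
         All.++⁺ (All.map⁺ (All.map (recompose-bounded a≤m p≤k) bndQ)) bndqs ,
         (λ { (here refl) → Any.++⁺ˡ (Any.map⁺ (Any.map (λ {x} → recompose-υ {x}) υ∈Q))
            ; (there υ∈)  → Any.++⁺ʳ _ (υ∈qs υ∈) }) ,
         (begin
           T k p (σ′ m) ++ assemble k σ′ ps
             ≡⟨ cong₂ _++_ (cong (T k p) eqQ) eqqs ⟩
           T k p (assemble k σ Q) ++ assemble k σ qs
             ≡⟨ cong (_++ assemble k σ qs) (T-assemble k p σ Q) ⟩
           assemble k σ (map (recompose p) Q) ++ assemble k σ qs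
             ≡⟨ concatMap-++ _ (map (recompose p) Q) qs ⟨
           assemble k σ (map (recompose p) Q ++ qs)
             ∎)
      where open ≡-Reasoning

  Prec-trans : ∀ {x y z} → IsSeq k z → Prec k x y → Prec k y z → Prec k x z
  Prec-trans sz (sx , x∈EV) y≺z@(sy , _) =
    sx , λ j → EVfrom-trans sy sz (λ {m} _ → ≺⇒EVfrom sz y≺z m) (x∈EV j)

  EVfrom-shift : ∀ c {σ j t} → EVfrom k j (shift c σ) t → EVfrom k (c + j) σ t
  EVfrom-shift c {σ} (ps , inc , bnd , υ∈ , refl) =
    map raise ps ,
    Linked.map⁺ (Linked.map (+-monoʳ-< c) inc) ,
    All.map⁺ (All.map (λ {(i , _)} (j≤i , p≤k) → +-monoʳ-≤ c j≤i , ≤-trans p≤k (k-mono (m≤n+m i c))) bnd) ,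
    Any.map⁺ υ∈ ,
    sym (concatMap-map (λ x → T k (proj₂ x) (σ (proj₁ x))) raise ps)
    where
    raise : ℕ × ℕ → ℕ × ℕ
    raise (i , p) = c + i , p

module _ (k : ℕ → ℕ) where

  choices : ℕ → ℕ → List (List (ℕ × ℕ))
  choices a zero    = [] ∷ []
  choices a (suc d) =
    choices (suc a) d ++ concatMap (λ p → map ((a , p) ∷_) (choices (suc a) d)) (upTo (suc (k (suc a))))

  InWindow : ℕ → ℕ → ℕ × ℕ → Set
  InWindow a d x = (a ≤ proj₁ x × proj₂ x ≤ k (suc (proj₁ x))) × proj₁ x < a + d

  narrow : ∀ {a d x} → a < proj₁ x → InWindow a (suc d) x → InWindow (suc a) d x
  narrow {a} {d} {x} a<j ((_ , q≤k) , j<) = (a<j , q≤k) , subst (proj₁ x <_) (+-suc a d) j<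

  ∈-choices : ∀ d {a ps} → Linked _<₁_ ps → All (InWindow a d) ps → ps ∈ choices a d
  ∈-choices zero    {_} {[]}    _ _ = here refl
  ∈-choices zero    {a} {_ ∷ _} _ (((a≤i , _) , i<a+0) ∷ _) =
    ⊥-elim (<⇒≱ (subst (_ <_) (+-identityʳ a) i<a+0) a≤i)
  ∈-choices (suc d) {_} {[]}    _ _ = ∈-++⁺ˡ (∈-choices d [] [])
  ∈-choices (suc d) {a} {(i , p) ∷ ps} inc (win@((a≤i , p≤k) , _) ∷ wins)
    with x<ps ∷ _ ← Linked⇒AllPairs₁ inc | m≤n⇒m<n∨m≡n a≤i
  ... | inj₁ a<i  = ∈-++⁺ˡ (∈-choices d inc
                      (All.zipWith (uncurry narrow) (a<i ∷ All.map (<-trans a<i) x<ps , win ∷ wins)))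
  ... | inj₂ refl = ∈-++⁺ʳ (choices (suc a) d)
                      (∈-concatMap⁺ (λ q → map ((a , q) ∷_) (choices (suc a) d))
                         (Any.map (λ { refl → ∈-map⁺ ((a , p) ∷_) ps∈ }) (∈-upTo⁺ (s≤s p≤k))))
    where ps∈ = ∈-choices d (Linked.tail inc) (All.zipWith (uncurry narrow) (x<ps , wins))

  Admissible : ℕ → List (ℕ × ℕ) → Set
  Admissible n ps = Linked _<₁_ ps × All (λ x → proj₁ x < n × proj₂ x ≤ k (suc (proj₁ x))) ps
                    × Any (λ x → proj₂ x ≡ 0) ps

  admissible? : ∀ n ps → Dec (Admissible n ps)
  admissible? n ps = Linked.linked? (λ x y → proj₁ x <? proj₁ y) ps
                     ×-dec All.all? (λ x → (proj₁ x <? n) ×-dec (proj₂ x ≤? k (suc (proj₁ x)))) ps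
                     ×-dec Any.any? (λ x → proj₂ x ≟ 0) ps

  admissibleChoices : ℕ → List (List (ℕ × ℕ))
  admissibleChoices n = filter (admissible? n) (choices 0 n)

  ∈-admissibleChoices : ∀ {n ps} → Admissible n ps → ps ∈ admissibleChoices n
  ∈-admissibleChoices adm@(inc , bnd , _) =
    ∈-filter⁺ (admissible? _) (∈-choices _ inc (All.map (λ (i<n , p≤k) → (z≤n , p≤k) , i<n) bnd)) adm

AllPairs-mapWithin : ∀ {A : Set} {P : A → Set} {R S : A → A → Set} {xs}
                   → (∀ {x y} → P x → P y → R x y → S x y) → All P xs → AllPairs R xs → AllPairs S xs
AllPairs-mapWithin f []         []         = []
AllPairs-mapWithin f (px ∷ pxs) (rx ∷ rxs) =
  All.zipWith (λ (py , r) → f px py r) (pxs , rx) ∷ AllPairs-mapWithin f pxs rxs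

extend : ℕ → Seq → Word → Seq
extend n h x i with i <? n
... | yes _ = h i
... | no  _ = x

extend-< : ∀ {n h x i} → i < n → extend n h x i ≡ h i
extend-< {n} {i = i} i<n with i <? n
... | yes _   = refl
... | no  i≮n = ⊥-elim (i≮n i<n)

extend-≡ : ∀ {n h x} → extend n h x n ≡ x
extend-≡ {n} with n <? n
... | yes n<n = ⊥-elim (<-irrefl refl n<n)
... | no  _   = refl

extend-elim : ∀ {n h x} (P : ℕ → Word → Set) → (∀ {i} → i < n → P i (h i)) → P n x
            → ∀ {i} → i < suc n → P i (extend n h x i)
extend-elim {n} {h} {x} P below top {i} i<1+n with m<1+n⇒m<n∨m≡n i<1+n
... | inj₁ i<n  = subst (P i) (sym (extend-< i<n)) (below i<n)
... | inj₂ refl = subst (P n) (sym (extend-≡ {n} {h})) top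

module Construction (k : ℕ → ℕ) (kstep : ∀ n → k (suc n) ≤ k (suc (suc n)))
    (w : Seq) (sw : IsSeq k w) (R : Word → Seq → Set)
    (hi : ∀ t s → InΠ k w t s → ∃ λ s₁ → R t s₁ × Prec k s₁ s)
    (hii : ∀ t s s₁ → R t s → Prec k s₁ s → R t s₁) where

  refineAll : ∀ (ts : List Word) {τ} → Prec k τ w → All (λ t → IsWord k t × (∀ j → t <ʷ τ j)) ts
            → ∃ λ σ → Prec k σ τ × All (λ t → R t σ) ts
  refineAll []       τ≺w [] = _ , Prec-refl (proj₁ τ≺w) , []
  refineAll (t ∷ ts) {τ} τ≺w ((t-word , t<τ) ∷ ts-below) =
    let (σ₁ , Rtσ₁ , σ₁≺τ) = hi t τ (t-word , proj₁ τ≺w , τ≺w , t<τ)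
        ts-below-σ₁ = All.map (λ (t′-word , t′<τ) → t′-word , λ j → <ʷ-EVfrom t′<τ (proj₂ σ₁≺τ j)) ts-below
        (σ , σ≺σ₁ , Rtsσ) = refineAll ts (Prec-trans kstep sw σ₁≺τ τ≺w) ts-below-σ₁
    in σ , Prec-trans kstep (proj₁ τ≺w) σ≺σ₁ σ₁≺τ , hii t σ₁ σ Rtσ₁ σ≺σ₁ ∷ Rtsσ

  -- prefix holds u₀ … u_(n-1); the terms of σ below index n play no role.
  record Stage (n : ℕ) : Set where
    field
      σ           : Seq
      prefix      : Seq
      σ≺w         : Prec k σ w
      prefix-word : ∀ {i} → i < n → IsWord k (prefix i)
      prefix-<    : ∀ {i j} → i < j → j < n → prefix i <ʷ prefix j
      prefix-<σ   : ∀ {i} → i < n → ∀ j → prefix i <ʷ σ j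
      prefix-R    : ∀ {ps} → Admissible k n ps → R (assemble k prefix ps) σ
  open Stage

  nextStage : ∀ {n} (S : Stage n) → Σ (Stage (suc n)) λ S′ → Prec k (σ S′) (shift (suc n) (σ S))
  nextStage {n} S = S′ , σ′≺τ
    where
    sσ = proj₁ (σ≺w S)
    τ = shift (suc n) (σ S)
    τ≺w = Prec-shift (suc n) (σ≺w S)
    prefix′ = extend n (prefix S) (σ S n)

    prefix′-word : ∀ {i} → i < suc n → IsWord k (prefix′ i)
    prefix′-word = extend-elim (λ _ → IsWord k) (prefix-word S) (proj₁ (sσ n))

    prefix′-<τ : ∀ {i} → i < suc n → ∀ j → prefix′ i <ʷ τ j
    prefix′-<τ = extend-elim (λ _ v → ∀ j → v <ʷ τ j)
                   (λ i<n j → prefix-<σ S i<n (suc n + j)) (λ j → IsSeq-<ʷ sσ (s≤s (m≤m+n n j)))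

    prefix′-< : ∀ {i j} → i < j → j < suc n → prefix′ i <ʷ prefix′ j
    prefix′-< i<j j<1+n = extend-elim (λ j v → ∀ {i} → i < j → prefix′ i <ʷ v)
      (λ j<n i<j → subst (_<ʷ _) (sym (extend-< (<-trans i<j j<n))) (prefix-< S i<j j<n))
      (λ i<n → subst (_<ʷ _) (sym (extend-< i<n)) (prefix-<σ S i<n n))
      j<1+n i<j

    candidate-ok : ∀ {ps} → Admissible k (suc n) ps
                 → IsWord k (assemble k prefix′ ps) × (∀ j → assemble k prefix′ ps <ʷ τ j)
    candidate-ok (inc , bnd , υ∈) =
      assemble-IsWord (All.map (prefix′-word ∘ proj₁) bnd)
        (AllPairs-mapWithin (λ _ (j<1+n , _) i<j → prefix′-< i<j j<1+n) bnd (Linked⇒AllPairs₁ inc)) υ∈ ,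
      λ j → assemble-<ʷ (All.map (λ (i<1+n , _) → prefix′-<τ i<1+n j) bnd)

    candidates = map (assemble k prefix′) (admissibleChoices k (suc n))

    refined = refineAll candidates τ≺w
      (All.map⁺ (All.map candidate-ok (All.all-filter (admissible? k (suc n)) (choices k 0 (suc n)))))
    σ′≺τ = proj₁ (proj₂ refined)

    S′ : Stage (suc n)
    S′ = record
      { σ           = proj₁ refined
      ; prefix      = prefix′
      ; σ≺w         = Prec-trans kstep sw σ′≺τ τ≺w
      ; prefix-word = prefix′-word
      ; prefix-<    = prefix′-<
      ; prefix-<σ   = λ i<1+n j → <ʷ-EVfrom (prefix′-<τ i<1+n) (proj₂ σ′≺τ j)
      ; prefix-R    = λ adm →
          All.lookup (proj₂ (proj₂ refined)) (∈-map⁺ (assemble k prefix′) (∈-admissibleChoices k adm))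
      }

  stage : ∀ n → Stage n
  stage zero = record
    { σ = w ; prefix = λ _ → [] ; σ≺w = Prec-refl sw
    ; prefix-word = λ () ; prefix-< = λ _ () ; prefix-<σ = λ ()
    ; prefix-R = λ { {[]} (_ , _ , ()) ; {_ ∷ _} (_ , (() , _) ∷ _ , _) } }
  stage (suc n) = proj₁ (nextStage (stage n))

  u : Seq
  u i = σ (stage i) i

  σ-IsSeq : ∀ n → IsSeq k (σ (stage n))
  σ-IsSeq n = proj₁ (σ≺w (stage n))

  prefix-stage : ∀ {n i} → i < n → prefix (stage n) i ≡ u i
  prefix-stage {suc n} {i} i<1+n with m<1+n⇒m<n∨m≡n i<1+n
  ... | inj₁ i<n  = trans (extend-< i<n) (prefix-stage i<n)
  ... | inj₂ refl = extend-≡ {n} {prefix (stage n)}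

  stage-step : ∀ n j → EVfrom k j (σ (stage n)) (σ (stage (suc n)) j)
  stage-step n j = EVfrom-mono (m≤n+m j (suc n)) (EVfrom-shift kstep (suc n)
    (≺⇒EVfrom (IsSeq-shift (suc n) (σ-IsSeq n)) (proj₂ (nextStage (stage n))) j))

  stage-descends : ∀ {n m} → n ≤ m → ∀ j → EVfrom k j (σ (stage n)) (σ (stage m) j)
  stage-descends {n} n≤m = go (≤⇒≤′ n≤m)
    where
    go : ∀ {m} → n ≤′ m → ∀ j → EVfrom k j (σ (stage n)) (σ (stage m) j)
    go ≤′-refl              j = ≺⇒EVfrom (σ-IsSeq n) (Prec-refl (σ-IsSeq n)) j
    go (≤′-step {m} n≤′m) j = EVfrom-trans kstep (σ-IsSeq m) (σ-IsSeq n) (λ _ → go n≤′m _) (stage-step m j)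

  u-IsSeq : IsSeq k u
  u-IsSeq m = proj₁ (σ-IsSeq m m) ,
    subst (_<ʷ u (suc m)) (prefix-stage (n<1+n m)) (prefix-<σ (stage (suc m)) (n<1+n m) (suc m))

  u≺w : Prec k u w
  u≺w = u-IsSeq , λ m → proj₂ (σ≺w (stage m)) m

  EV-u⇒R : ∀ {t} → EV k u t → ∀ {l} → t <ʷ u l → ∀ {s} → PrecFrom k l s u → R t s
  EV-u⇒R (ps , inc , bnd , υ∈ , refl) {l} t<uₗ {s} (ss , s∈EV) = hii _ _ s R-σₗ s≺σₗ
    where
    ps<l : All (λ x → proj₁ x < l) ps
    ps<l = All.map (IsSeq-index-< u-IsSeq) (assemble-<ʷ⁻ ps t<uₗ)

    R-σₗ : R (assemble k u ps) (σ (stage l))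
    R-σₗ = subst (λ t → R t _) (assemble-cong ps (All.map prefix-stage ps<l))
             (prefix-R (stage l) (inc , All.zip (ps<l , All.map proj₂ bnd) , υ∈))

    s≺σₗ : Prec k s (σ (stage l))
    s≺σₗ = ss , λ j →
      EVfrom-mono z≤n (EVfrom-trans kstep u-IsSeq (σ-IsSeq l) (λ l≤m → stage-descends l≤m _) (s∈EV j))

lemma2p6 : (k : ℕ → ℕ) → (∀ n → 1 ≤ k (suc n)) → (∀ n → k (suc n) ≤ k (suc (suc n)))
    → (w : Seq) → IsSeq k w
    → (R : Word → Seq → Set)
    → (∀ t s → R t s → InΠ k w t s)
    → (∀ t s → InΠ k w t s → ∃ λ s₁ → R t s₁ × Prec k s₁ s)
    → (∀ t s s₁ → R t s → Prec k s₁ s → R t s₁)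
    → ∃ λ u → Prec k u w
        × (∀ t → EV k u t
             → ∀ l → t <ʷ u l → (∀ m → m < l → ¬ (t <ʷ u m))
             → ∀ s → PrecFrom k l s u → R t s)
lemma2p6 k _ kstep w sw R _ hi hii = u , u≺w , λ t t∈EV l t<uₗ _ s s≺u-t → EV-u⇒R t∈EV t<uₗ s≺u-t
  where open Construction k kstep w sw R hi hii
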